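{- Let $Z$ be a set, let $\mathcal{Y}\subseteq\mathcal{P}(Z)$ be closed under finite unions, and let $\mu:\mathcal{Y}\to\mathcal{P}(Z)$ satisfy $(\mu\subseteq)$, $(\mu PR)$ and $(\mu CUM)$. Let $U\in\mathcal{Y}$ and $x\in K$. Then (1) $x\in\mu(U)$ iff $x\in U$ and there exists $f\in\Gamma_x$ with $\mathrm{ran}(f)\cap U=\emptyset$; (2) $x\in\mu(U)$ iff $x\in U$ and there exists $f\in\Gamma_x$ with $\mathrm{ran}(f)\cap H(U)=\emptyset$.
   Context: For all $X,Y\in\mathcal{Y}$: $(\mu\subseteq)$ $\mu(X)\subseteq X$; $(\mu PR)$ $X\subseteq Y\Rightarrow\mu(Y)\cap X\subseteq\mu(X)$; $(\mu CUM)$ $\mu(X)\subseteq Y\subseteq X\Rightarrow\mu(Y)=\mu(X)$. $H(U):=\bigcup\{X\in\mathcal{Y}:\mu(X)\subseteq U\}$. $K:=\{x\in Z:\exists X\in\mathcal{Y}.\,x\in\mu(X)\}$. For $x\in Z$, $\mathcal{W}_x:=\{\mu(Y):Y\in\mathcal{Y},\ x\in Y-\mu(Y)\}$ and $\Gamma_x:=\Pi\mathcal{W}_x$, the set of functions $f$ with domain $\mathcal{W}_x$ such that $f(W)\in W$ for every $W\in\mathcal{W}_x$ (so $\Gamma_x=\{\emptyset\}$ if $\mathcal{W}_x=\emptyset$). -}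

module Defs where

open import Data.Product using (Σ; Σ-syntax; ∃; _×_; proj₁)
open import Data.Sum using (_⊎_)
open import Relation.Nullary using (¬_)

Sub : Set → Set₁
Sub Z = Z → Set

module _ {Z : Set} where

  _⊆_ : Sub Z → Sub Z → Set
  A ⊆ B = ∀ z → A z → B z

  _≐_ : Sub Z → Sub Z → Set
  A ≐ B = (A ⊆ B) × (B ⊆ A)

  _∪_ : Sub Z → Sub Z → Sub Z
  (A ∪ B) z = A z ⊎ B z

-- A family 𝒴 ⊆ 𝒫(Z), presented as an indexed family  𝒴 = {Y i : i ∈ I}.
-- μ : 𝒴 → 𝒫(Z) is given on indices:  μ i  stands for  μ(Y i).
record Setting (Z : Set) : Set₁ where
  field
    I : Set
    Y : I → Sub Z
    μ : I → Sub Z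

module _ {Z : Set} (S : Setting Z) where
  open Setting S

  -- 𝒴 closed under (binary, hence all nonempty finite) unions
  UnionClosed : Set
  UnionClosed = ∀ i j → Σ[ k ∈ I ] (Y k ≐ (Y i ∪ Y j))

  μ⊆ : Set
  μ⊆ = ∀ i → μ i ⊆ Y i

  μPR : Set
  μPR = ∀ i j → Y i ⊆ Y j → (λ z → μ j z × Y i z) ⊆ μ i

  μCUM : Set
  μCUM = ∀ i j → μ i ⊆ Y j → Y j ⊆ Y i → μ j ≐ μ i

  H : Sub Z → Sub Z
  H U z = Σ[ i ∈ I ] (μ i ⊆ U × Y i z)

  K : Sub Z
  K x = Σ[ i ∈ I ] μ i x

  InW : Z → Sub Z → Set
  InW x W = Σ[ i ∈ I ] ((μ i ≐ W) × Y i x × ¬ μ i x)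

  Γ : Z → Set₁
  Γ x = (W : Sub Z) → InW x W → Σ[ z ∈ Z ] W z

  RanDisjoint : {x : Z} → Γ x → Sub Z → Set₁
  RanDisjoint f A = ∀ W p → ¬ A (proj₁ (f W p))

module Submission where

-- Write  V ⊔ X  for the union of two members of 𝒴.
-- (a) Absorption: if μ(X) ⊆ V then μ(V ⊔ X) = μ(V) (by μCUM, since μPR puts
--     the X-part of μ(V ⊔ X) into μ(X) ⊆ V); hence μ(V) ∩ X ⊆ μ(X) (μPR).
-- (b) Consequently μ(V) ∩ H(A) ⊆ A whenever A ⊆ V.
-- (c) If x ∈ μ(U) and x ∈ Y − μ(Y), then μ(Y ⊔ U) ⊄ U: otherwise μCUM gives
--     μ(U) = μ(Y ⊔ U), and μPR would put x into μ(Y).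
-- (d) Classically, (c) yields z ∈ μ(Y ⊔ U) − U; such z lies in Y, hence in
--     μ(Y) by μPR, and not in H(U) by (b).  So every W ∈ 𝒲_x meets Z − H(U),
--     and choosing such points (by excluded middle) gives f ∈ Γ_x with
--     ran(f) ∩ H(U) = ∅; as U ⊆ H(U), also ran(f) ∩ U = ∅.
-- (e) Conversely, if x ∈ U − μ(U) then μ(U) ∈ 𝒲_x, and f(μ(U)) ∈ μ(U) ⊆ U,
--     so no f ∈ Γ_x has range disjoint from any A ⊇ U.

open import Defs
open import Level using (0ℓ)
open import Data.Product using (Σ-syntax; _×_; _,_; proj₁; proj₂)
open import Data.Sum using (_⊎_; inj₁; inj₂)
open import Data.Empty using (⊥-elim)
open import Relation.Nullary using (¬_; yes; no)
open import Function.Bundles using (_⇔_; mk⇔)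
open import Axiom.ExcludedMiddle using (ExcludedMiddle)
open Setting

ranDisjoint-anti : {Z : Set} (S : Setting Z) {x : Z} (f : Γ S x) {A B : Sub Z} →
                   A ⊆ B → RanDisjoint S f B → RanDisjoint S f A
ranDisjoint-anti S f A⊆B disj W p a = disj W p (A⊆B _ a)

module Laws {Z : Set} (S : Setting Z) (uc : UnionClosed S)
            (m⊆ : μ⊆ S) (pr : μPR S) (cum : μCUM S) where

  _⊔_ : I S → I S → I S
  i ⊔ j = proj₁ (uc i j)

  ⊆⊔ˡ : ∀ i j → Y S i ⊆ Y S (i ⊔ j)
  ⊆⊔ˡ i j z p = proj₂ (proj₂ (uc i j)) z (inj₁ p)

  ⊆⊔ʳ : ∀ i j → Y S j ⊆ Y S (i ⊔ j)
  ⊆⊔ʳ i j z p = proj₂ (proj₂ (uc i j)) z (inj₂ p)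

  ⊔-split : ∀ i j z → Y S (i ⊔ j) z → Y S i z ⊎ Y S j z
  ⊔-split i j = proj₁ (proj₂ (uc i j))

  Y⊆H : ∀ u → Y S u ⊆ H S (Y S u)
  Y⊆H u z p = u , m⊆ u , p

  μ-absorb : ∀ v X → μ S X ⊆ Y S v → μ S v ≐ μ S (v ⊔ X)
  μ-absorb v X μX⊆V = cum (v ⊔ X) v μ⊔⊆V (⊆⊔ˡ v X)
    where
    μ⊔⊆V : μ S (v ⊔ X) ⊆ Y S v
    μ⊔⊆V w p with ⊔-split v X w (m⊆ (v ⊔ X) w p)
    ... | inj₁ q = q
    ... | inj₂ q = μX⊆V w (pr X (v ⊔ X) (⊆⊔ʳ v X) w (p , q))

  μ-restrict : ∀ v X → μ S X ⊆ Y S v → ∀ z → μ S v z → Y S X z → μ S X z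
  μ-restrict v X μX⊆V z zμv zX =
    pr X (v ⊔ X) (⊆⊔ʳ v X) z (proj₁ (μ-absorb v X μX⊆V) z zμv , zX)

  μ∩H⊆ : ∀ v (A : Sub Z) → A ⊆ Y S v → ∀ z → μ S v z → H S A z → A z
  μ∩H⊆ v A A⊆V z zμv (X , μX⊆A , zX) =
    μX⊆A z (μ-restrict v X (λ w p → A⊆V w (μX⊆A w p)) z zμv zX)

  μ⊔-⊈ : ∀ u i x → μ S u x → Y S i x → ¬ μ S i x → ¬ (μ S (i ⊔ u) ⊆ Y S u)
  μ⊔-⊈ u i x xμu xi xμ̸i μ⊔⊆U =
    xμ̸i (pr i (i ⊔ u) (⊆⊔ˡ i u) x (μU⊆μ⊔ x xμu , xi))
    where
    μU⊆μ⊔ : μ S u ⊆ μ S (i ⊔ u)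
    μU⊆μ⊔ = proj₁ (cum (i ⊔ u) u μ⊔⊆U (⊆⊔ʳ i u))

⊈-witness : ExcludedMiddle 0ℓ → {Z : Set} {A B : Sub Z} →
            ¬ (A ⊆ B) → Σ[ z ∈ Z ] (A z × ¬ B z)
⊈-witness em {Z} {A} {B} A⊈B with em {Σ[ z ∈ Z ] (A z × ¬ B z)}
... | yes w = w
... | no ¬w = ⊥-elim (A⊈B A⊆B)
  where
  A⊆B : A ⊆ B
  A⊆B z a with em {B z}
  ... | yes b = b
  ... | no ¬b = ⊥-elim (¬w (z , a , ¬b))

module Classical (em : ExcludedMiddle 0ℓ) {Z : Set} (S : Setting Z)
                 (uc : UnionClosed S) (m⊆ : μ⊆ S) (pr : μPR S) (cum : μCUM S) where
  open Laws S uc m⊆ pr cum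

  escape : ∀ u i x → μ S u x → Y S i x → ¬ μ S i x →
           Σ[ z ∈ Z ] (μ S i z × ¬ H S (Y S u) z)
  escape u i x xμu xi xμ̸i with ⊈-witness em (μ⊔-⊈ u i x xμu xi xμ̸i)
  ... | z , zμ⊔ , z∉U = z , zμi , z∉H
    where
    zi : Y S i z
    zi with ⊔-split i u z (m⊆ (i ⊔ u) z zμ⊔)
    ... | inj₁ q = q
    ... | inj₂ q = ⊥-elim (z∉U q)

    zμi : μ S i z
    zμi = pr i (i ⊔ u) (⊆⊔ˡ i u) z (zμ⊔ , zi)

    z∉H : ¬ H S (Y S u) z
    z∉H h = z∉U (μ∩H⊆ (i ⊔ u) (Y S u) (⊆⊔ʳ i u) z zμ⊔ h)

  avoiding-choice : ∀ u x → μ S u x → Σ[ f ∈ Γ S x ] RanDisjoint S f (H S (Y S u))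
  avoiding-choice u x xμu = f , λ W p → proj₂ (proj₂ (pick W p))
    where
    pick : (W : Sub Z) → InW S x W → Σ[ z ∈ Z ] (W z × ¬ H S (Y S u) z)
    pick W (i , (μi⊆W , _) , xi , xμ̸i) with escape u i x xμu xi xμ̸i
    ... | z , zμi , z∉H = z , μi⊆W z zμi , z∉H

    f : Γ S x
    f W p = proj₁ (pick W p) , proj₁ (proj₂ (pick W p))

avoiding-choice⇒μ : ExcludedMiddle 0ℓ → {Z : Set} (S : Setting Z) → μ⊆ S →
                    ∀ u x (A : Sub Z) → Y S u ⊆ A →
                    Y S u x × Σ[ f ∈ Γ S x ] RanDisjoint S f A → μ S u x
avoiding-choice⇒μ em S m⊆ u x A U⊆A (xU , f , disj) with em {μ S u x}
... | yes xμu = xμu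
... | no xμ̸u = ⊥-elim (disj (μ S u) μU∈𝒲 (U⊆A _ (m⊆ u _ (proj₂ (f (μ S u) μU∈𝒲)))))
  where
  μU∈𝒲 : InW S x (μ S u)
  μU∈𝒲 = u , ((λ _ p → p) , (λ _ p → p)) , xU , xμ̸u

claim3p17 : ExcludedMiddle 0ℓ →
    (Z : Set) (S : Setting Z) →
    UnionClosed S → μ⊆ S → μPR S → μCUM S →
    (u : I S) → (x : Z) → K S x →
    (μ S u x ⇔ (Y S u x × Σ[ f ∈ Γ S x ] RanDisjoint S f (Y S u)))
    × (μ S u x ⇔ (Y S u x × Σ[ f ∈ Γ S x ] RanDisjoint S f (H S (Y S u))))
claim3p17 em _ S uc m⊆ pr cum u x _ =
    mk⇔ avoidU (avoiding-choice⇒μ em S m⊆ u x (Y S u) (λ _ p → p))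
  , mk⇔ avoidH (avoiding-choice⇒μ em S m⊆ u x (H S (Y S u)) (Y⊆H u))
  where
  open Laws S uc m⊆ pr cum using (Y⊆H)
  open Classical em S uc m⊆ pr cum using (avoiding-choice)

  avoidH : μ S u x → Y S u x × Σ[ f ∈ Γ S x ] RanDisjoint S f (H S (Y S u))
  avoidH xμu = m⊆ u x xμu , avoiding-choice u x xμu

  avoidU : μ S u x → Y S u x × Σ[ f ∈ Γ S x ] RanDisjoint S f (Y S u)
  avoidU xμu with avoiding-choice u x xμu
  ... | f , disj = m⊆ u x xμu , f , ranDisjoint-anti S f (Y⊆H u) disj
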